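{- Let $\mathbf{C}$ be a category and let $C,D\in\mathrm{Ob}(\mathbf{C})$ be hom-equivalent, i.e. $\hom(C,D)\neq\varnothing$ and $\hom(D,C)\neq\varnothing$. Then $\overline{\mathrm{Age}}(C)=\overline{\mathrm{Age}}(D)$, and for every $A\in\mathrm{Ob}(\overline{\mathrm{Age}}(C))$ we have $T(A,C)=T(A,D)$.
   Context: $\overline{\mathrm{Age}}(C)$ is the full subcategory of $\mathbf{C}$ spanned by all objects $A$ with $\hom(A,C)\neq\varnothing$. Write $C\longrightarrow(B)^A_{k,t}$ if for every map $\chi:\hom(A,C)\to\{0,\dots,k-1\}$ there is $w\in\hom(B,C)$ with $|\chi(w\cdot\hom(A,B))|\le t$. For $A\in\overline{\mathrm{Age}}(C)$, $T(A,C)$ is the least positive integer $t$ with $C\longrightarrow(C)^A_{k,t}$ for all $k\ge2$, and $\infty$ if none exists. -}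

module Defs where

open import Level using (Level; _⊔_; suc)
open import Data.Nat using (ℕ; _≤_)
open import Data.Fin using (Fin)
open import Data.Fin.Subset using (Subset; _∈_; ∣_∣)
open import Data.Product using (Σ; _×_)
open import Data.Empty using (⊥)
open import Relation.Binary.PropositionalEquality using (_≡_)

record Category (o ℓ : Level) : Set (Level.suc (o ⊔ ℓ)) where
  infixr 9 _∘_
  field
    Obj  : Set o
    Hom  : Obj → Obj → Set ℓ
    id   : ∀ {A} → Hom A A
    _∘_  : ∀ {A B C} → Hom B C → Hom A B → Hom A C
    assoc : ∀ {A B C D} (h : Hom C D) (g : Hom B C) (f : Hom A B) →
            (h ∘ g) ∘ f ≡ h ∘ (g ∘ f)
    identityˡ : ∀ {A B} (f : Hom A B) → id ∘ f ≡ f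
    identityʳ : ∀ {A B} (f : Hom A B) → f ∘ id ≡ f

module _ {o ℓ : Level} (𝐂 : Category o ℓ) where
  open Category 𝐂

  -- A ∈ Ob(Age‾(C))  iff  hom(A,C) ≠ ∅ (witnessed by an element)
  InAge : Obj → Obj → Set ℓ
  InAge C A = Hom A C

  -- C ⟶ (B)^A_{k,t}: for every colouring χ : hom(A,C) → Fin k there is
  -- w ∈ hom(B,C) with |χ(w · hom(A,B))| ≤ t, i.e. the image is contained in
  -- a set of at most t colours.
  Arrow : (C B A : Obj) (k t : ℕ) → Set ℓ
  Arrow C B A k t =
    (χ : Hom A C → Fin k) →
    Σ (Hom B C) λ w → Σ (Subset k) λ S →
      (∣ S ∣ ≤ t) × ((f : Hom A B) → χ (w ∘ f) ∈ S)

  Works : (A C : Obj) → ℕ → Set ℓ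
  Works A C t = (k : ℕ) → 2 ≤ k → Arrow C C A k t

data ℕ∞ : Set where
  fin : ℕ → ℕ∞
  ∞   : ℕ∞

module _ {o ℓ : Level} (𝐂 : Category o ℓ) where
  open Category 𝐂

  IsT : (A C : Obj) → ℕ∞ → Set ℓ
  IsT A C (fin t) =
    (1 ≤ t) × Works 𝐂 A C t × ((s : ℕ) → 1 ≤ s → Works 𝐂 A C s → t ≤ s)
  IsT A C ∞ = (t : ℕ) → 1 ≤ t → Works 𝐂 A C t → ⊥

-- A Ramsey arrow C ⟶ (B)^A_{k,t} may be post-composed with any map C → D
-- (pull the colouring back along it) and pre-composed with any map B' → B
-- (restrict the witness).  With maps C → D and D → C, every t that works for
-- C works for D and conversely, so the least such t agrees.
module Submission where

open import Defs
open import Level using (Level)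
open import Data.Product using (_×_; _,_)
open import Function.Bundles using (_⇔_; mk⇔)
open import Data.Fin.Subset using (_∈_)
open import Relation.Binary.PropositionalEquality using (subst; sym)

module _ {o ℓ : Level} (𝐂 : Category o ℓ) where
  open Category 𝐂

  InAge-postcompose : ∀ {C D A} → Hom C D → InAge 𝐂 C A → InAge 𝐂 D A
  InAge-postcompose f h = f ∘ h

  Arrow-postcompose : ∀ {C D B A k t} → Hom C D → Arrow 𝐂 C B A k t → Arrow 𝐂 D B A k t
  Arrow-postcompose f arrow χ with arrow (λ h → χ (f ∘ h))
  ... | w , S , ∣S∣≤t , χ[w∘-]∈S =
    f ∘ w , S , ∣S∣≤t , λ h → subst (λ e → χ e ∈ S) (sym (assoc f w h)) (χ[w∘-]∈S h)

  Arrow-precompose : ∀ {C B B′ A k t} → Hom B′ B → Arrow 𝐂 C B A k t → Arrow 𝐂 C B′ A k t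
  Arrow-precompose g arrow χ with arrow χ
  ... | w , S , ∣S∣≤t , χ[w∘-]∈S =
    w ∘ g , S , ∣S∣≤t , λ h → subst (λ e → χ e ∈ S) (sym (assoc w g h)) (χ[w∘-]∈S (g ∘ h))

  Works-transfer : ∀ {C D A t} → Hom C D → Hom D C → Works 𝐂 A C t → Works 𝐂 A D t
  Works-transfer f g works k 2≤k =
    Arrow-precompose g (Arrow-postcompose f (works k 2≤k))

  IsT-transfer : ∀ {C D A} → Hom C D → Hom D C → (v : ℕ∞) → IsT 𝐂 A C v → IsT 𝐂 A D v
  IsT-transfer f g (fin t) (1≤t , works , least) =
    1≤t , Works-transfer f g works , λ s 1≤s worksD → least s 1≤s (Works-transfer g f worksD)
  IsT-transfer f g ∞ none t 1≤t worksD = none t 1≤t (Works-transfer g f worksD)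

lemma4p1 : {o ℓ : Level} (𝐂 : Category o ℓ) (C D : Category.Obj 𝐂) →
    Category.Hom 𝐂 C D → Category.Hom 𝐂 D C →
    ((A : Category.Obj 𝐂) → InAge 𝐂 C A ⇔ InAge 𝐂 D A) ×
    ((A : Category.Obj 𝐂) → InAge 𝐂 C A → (v : ℕ∞) → IsT 𝐂 A C v ⇔ IsT 𝐂 A D v)
lemma4p1 𝐂 C D f g =
  (λ A → mk⇔ (InAge-postcompose 𝐂 f) (InAge-postcompose 𝐂 g)) ,
  (λ A _ v → mk⇔ (IsT-transfer 𝐂 f g v) (IsT-transfer 𝐂 g f v))
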